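{- Let $\mathbf G=(g_i)_{1\le i\le k}$ with $g_i:\mathbb{N}^p\to\mathbb{N}$, let $\mathbf A=(a_{i,j})_{1\le i,j\le k}$ and $\mathbf B=(b_i)_{1\le i\le k}$ with $a_{i,j},b_i:\mathbb{N}^{p+1}\to\mathbb{Z}$, and let $\mathbf f:\mathbb{N}^{p+1}\to\mathbb{Z}^k$ be the unique solution of $\mathbf f(x+1,\mathbf y)-\mathbf f(x,\mathbf y)=\mathbf A(x,\mathbf y)\mathbf f(x,\mathbf y)+\mathbf B(x,\mathbf y)$, $\mathbf f(0,\mathbf y)=\mathbf G(\mathbf y)$. If $\mathbf G$, $\tilde{\mathbf A}$ and $\tilde{\mathbf B}$ are elementary, then $\tilde{\mathbf f}$ is elementary.
   Context: Integers are represented by $\tilde{\mathbb{Z}}=\{0,1\}\times\mathbb{N}$, the pair $(s,n)$ encoding $(-1)^sn$; for a function with values in $\mathbb{Z}$, the tilde version is the corresponding function with values in $\tilde{\mathbb{Z}}$; vector/matrix functions are elementary when all their components are. Elementary functions: the smallest class of functions $\mathbb{N}^p\to\mathbb{N}$ containing $\mathbf 0$, projections, successor, addition, truncated subtraction $\max(0,n_1-n_2)$, and closed under composition, bounded sum $\sum_{z\le x}g(z,\mathbf y)$ and bounded product $\prod_{z\le x}g(z,\mathbf y)$. -}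

module Defs where

open import Data.Nat using (ℕ; zero; suc; _+_; _∸_)
open import Data.Fin using (Fin)
open import Data.Vec using (Vec; _∷_; []; lookup; tabulate)
open import Data.Integer as ℤ using (ℤ; +_; -[1+_])
open import Data.Product using (Σ; _×_; _,_)
open import Relation.Binary.PropositionalEquality using (_≡_)

data EF : ℕ → Set where
  zeroF : ∀ {p} → EF p
  proj  : ∀ {p} → Fin p → EF p
  succF : EF 1
  addF  : EF 2
  monus : EF 2
  comp  : ∀ {m p} → EF m → (Fin m → EF p) → EF p
  bsum  : ∀ {p} → EF (suc p) → EF (suc p)
  bprod : ∀ {p} → EF (suc p) → EF (suc p)

sumTo : (ℕ → ℕ) → ℕ → ℕ
sumTo h zero    = h zero
sumTo h (suc x) = sumTo h x + h (suc x)

prodTo : (ℕ → ℕ) → ℕ → ℕ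
prodTo h zero    = h zero
prodTo h (suc x) = prodTo h x Data.Nat.* h (suc x)

⟦_⟧ : ∀ {p} → EF p → Vec ℕ p → ℕ
⟦ zeroF ⟧ v = 0
⟦ proj i ⟧ v = lookup v i
⟦ succF ⟧ (n ∷ []) = suc n
⟦ addF ⟧ (a ∷ b ∷ []) = a + b
⟦ monus ⟧ (a ∷ b ∷ []) = a ∸ b
⟦ comp h gs ⟧ v = ⟦ h ⟧ (tabulate (λ i → ⟦ gs i ⟧ v))
⟦ bsum g ⟧ (x ∷ y) = sumTo (λ z → ⟦ g ⟧ (z ∷ y)) x
⟦ bprod g ⟧ (x ∷ y) = prodTo (λ z → ⟦ g ⟧ (z ∷ y)) x

Elementary : (p : ℕ) → (Vec ℕ p → ℕ) → Set
Elementary p f = Σ (EF p) λ e → ∀ v → ⟦ e ⟧ v ≡ f v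

-- Encoding ℤ → ℤ̃ = {0,1} × ℕ, (s,n) ↦ (-1)^s n; nonnegative integers get sign 0.
sgnBit : ℤ → ℕ
sgnBit (+ n)     = 0
sgnBit -[1+ n ]  = 1

-- Elementary ℤ-valued function: its tilde version (both components) is elementary.
ElementaryZ : (p : ℕ) → (Vec ℕ p → ℤ) → Set
ElementaryZ p f = Elementary p (λ v → sgnBit (f v)) × Elementary p (λ v → ℤ.∣ f v ∣)

ElementaryVec : (p k : ℕ) → (Vec ℕ p → Fin k → ℕ) → Set
ElementaryVec p k G = (i : Fin k) → Elementary p (λ v → G v i)

ElementaryZVec : (p k : ℕ) → (Vec ℕ p → Fin k → ℤ) → Set
ElementaryZVec p k B = (i : Fin k) → ElementaryZ p (λ v → B v i)

ElementaryZMat : (p k : ℕ) → (Vec ℕ p → Fin k → Fin k → ℤ) → Set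
ElementaryZMat p k A = (i j : Fin k) → ElementaryZ p (λ v → A v i j)

sumFin : ∀ {k} → (Fin k → ℤ) → ℤ
sumFin {zero}  h = + 0
sumFin {suc k} h = h Fin.zero ℤ.+ sumFin (λ j → h (Fin.suc j))
  where import Data.Fin as Fin

solution : (p k : ℕ) → (Vec ℕ p → Fin k → ℕ)
         → (Vec ℕ (suc p) → Fin k → Fin k → ℤ) → (Vec ℕ (suc p) → Fin k → ℤ)
         → ℕ → Vec ℕ p → Fin k → ℤ
solution p k G A B zero    y i = + G y i
solution p k G A B (suc x) y i =
  solution p k G A B x y i
  ℤ.+ (sumFin (λ j → A (x ∷ y) i j ℤ.* solution p k G A B x y j)
  ℤ.+ B (x ∷ y) i)

solutionAt : (p k : ℕ) → (Vec ℕ p → Fin k → ℕ)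
           → (Vec ℕ (suc p) → Fin k → Fin k → ℤ) → (Vec ℕ (suc p) → Fin k → ℤ)
           → Vec ℕ (suc p) → Fin k → ℤ
solutionAt p k G A B (x ∷ y) = solution p k G A B x y

module Submission where

-- With K = k + 1 the vector (1, f(x, y)) satisfies v(x + 1) = M(x, y) v(x) for a K × K matrix M
-- with ℤ-elementary entries, so f(x, y) is a sum, over the K^x paths through M(x − 1), …, M(0),
-- of the product of the entries met along the path times an entry of (1, G(y)). Coding a path by
-- the base-K digits of a number s < K^x, the number of negative factors and the absolute value of
-- each such product are a bounded sum and a bounded product of elementary functions of (s, x, y).
-- Adding up the absolute values of the positive and of the negative products gives elementary
-- P and N with f = P − N, and the sign bit and absolute value of P − N are elementary.

open import Defs
open import Algebra.Bundles using (Monoid)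
open import Data.Nat as ℕ using (ℕ; zero; suc; NonZero)
import Data.Nat.Properties as ℕ
open import Data.Fin as Fin using (Fin; toℕ; zero; suc)
open import Data.Vec using (Vec; _∷_; []; lookup; tabulate; head; tail)
open import Data.Integer using (ℤ; +_; -[1+_])
import Data.Integer.Properties as ℤ
open import Data.Vec.Properties using (tabulate∘lookup; tabulate-cong)
open import Data.Product using (_,_; proj₁; proj₂)
open import Function using (_∘_)
open import Relation.Nullary using (yes; no)
open import Relation.Binary.PropositionalEquality
  using (_≡_; refl; sym; trans; cong; cong₂; subst; _≗_; module ≡-Reasoning)

module Fold {c ℓ} (M : Monoid c ℓ) where
  open Monoid M
    renaming (refl to ≈-refl; sym to ≈-sym; trans to ≈-trans; reflexive to ≈-reflexive)
  open import Relation.Binary.Reasoning.Setoid setoid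
  open import Data.Nat using (_+_; _*_)

  fold< : (ℕ → Carrier) → ℕ → Carrier
  fold< f zero    = ε
  fold< f (suc n) = fold< f n ∙ f n

  fold<-cong : ∀ {f g} → (∀ z → f z ≈ g z) → ∀ n → fold< f n ≈ fold< g n
  fold<-cong f≈g zero    = ≈-refl
  fold<-cong f≈g (suc n) = ∙-cong (fold<-cong f≈g n) (f≈g n)

  fold<-front : ∀ f n → fold< f (suc n) ≈ f 0 ∙ fold< (f ∘ suc) n
  fold<-front f zero    = ≈-trans (identityˡ (f 0)) (≈-sym (identityʳ (f 0)))
  fold<-front f (suc n) = begin
    fold< f (suc n) ∙ f (suc n)               ≈⟨ ∙-congʳ (fold<-front f n) ⟩
    (f 0 ∙ fold< (f ∘ suc) n) ∙ f (suc n)     ≈⟨ assoc _ _ _ ⟩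
    f 0 ∙ fold< (f ∘ suc) (suc n)             ∎

  fold<-+ : ∀ f m n → fold< f (m + n) ≈ fold< f m ∙ fold< (λ z → f (m + z)) n
  fold<-+ f m zero    = ≈-trans (≈-reflexive (cong (fold< f) (ℕ.+-identityʳ m))) (≈-sym (identityʳ _))
  fold<-+ f m (suc n) = begin
    fold< f (m + suc n)                                   ≡⟨ cong (fold< f) (ℕ.+-suc m n) ⟩
    fold< f (m + n) ∙ f (m + n)                           ≈⟨ ∙-congʳ (fold<-+ f m n) ⟩
    (fold< f m ∙ fold< (λ z → f (m + z)) n) ∙ f (m + n)   ≈⟨ assoc _ _ _ ⟩
    fold< f m ∙ fold< (λ z → f (m + z)) (suc n)           ∎

  fold<-* : ∀ f m n → fold< f (m * n) ≈ fold< (λ s → fold< (λ c → f (s * n + c)) n) m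
  fold<-* f zero    n = ≈-refl
  fold<-* f (suc m) n = begin
    fold< f (suc m * n)                                       ≡⟨ cong (fold< f) (ℕ.+-comm n (m * n)) ⟩
    fold< f (m * n + n)                                       ≈⟨ fold<-+ f (m * n) n ⟩
    fold< f (m * n) ∙ fold< (λ c → f (m * n + c)) n           ≈⟨ ∙-congʳ (fold<-* f m n) ⟩
    fold< (λ s → fold< (λ c → f (s * n + c)) n) (suc m)       ∎

open Fold ℕ.+-0-monoid using () renaming (fold< to ∑<; fold<-cong to ∑<-cong)
open Fold ℕ.*-1-monoid using () renaming (fold< to ∏<; fold<-cong to ∏<-cong)
open Fold ℤ.+-0-monoid using () renaming (fold< to ∑<ℤ; fold<-cong to ∑<ℤ-cong; fold<-* to ∑<ℤ-*)
open Fold ℤ.*-1-monoid using () renaming (fold< to ∏<ℤ; fold<-cong to ∏<ℤ-cong; fold<-front to ∏<ℤ-front)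

module ElementaryClosure where
  open import Data.Nat using (_+_; _*_; _∸_; _^_; _⊓_; _≤_; _<_; _≤?_)
  open import Data.Nat.DivMod using (_/_; _%_; _mod_; m*n/n≡m; m/n*n≤m; m/n≤m; /-monoˡ-≤; m%n≡m∸m/n*n)
  open import Data.Fin.Properties using (toℕ-fromℕ<)

  Elementaryⱽ : (p m : ℕ) → (Vec ℕ p → Vec ℕ m) → Set
  Elementaryⱽ p m F = (i : Fin m) → Elementary p (λ v → lookup (F v) i)

  Elementary-resp-≗ : ∀ {p} {f g : Vec ℕ p → ℕ} → f ≗ g → Elementary p f → Elementary p g
  Elementary-resp-≗ f≗g (e , e≗f) = e , λ v → trans (e≗f v) (f≗g v)

  elementary-const : ∀ {p} c → Elementary p (λ _ → c)
  elementary-const zero    = zeroF , λ _ → refl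
  elementary-const (suc c) with elementary-const c
  ... | e , e≗c = comp succF (λ _ → e) , λ v → cong suc (e≗c v)

  elementary-lookup : ∀ {p} (i : Fin p) → Elementary p (λ v → lookup v i)
  elementary-lookup i = proj i , λ _ → refl

  elementary-∘ : ∀ {p m} {h : Vec ℕ m → ℕ} {F : Vec ℕ p → Vec ℕ m} →
                 Elementary m h → Elementaryⱽ p m F → Elementary p (h ∘ F)
  elementary-∘ {F = F} (e , e≗h) eF = comp e (proj₁ ∘ eF) , λ v → begin
    ⟦ e ⟧ (tabulate λ i → ⟦ proj₁ (eF i) ⟧ v)   ≡⟨ cong ⟦ e ⟧ (tabulate-cong λ i → proj₂ (eF i) v) ⟩
    ⟦ e ⟧ (tabulate (lookup (F v)))            ≡⟨ cong ⟦ e ⟧ (tabulate∘lookup (F v)) ⟩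
    ⟦ e ⟧ (F v)                                ≡⟨ e≗h (F v) ⟩
    _                                          ∎
    where open ≡-Reasoning

  []ᵉ : ∀ {p} → Elementaryⱽ p 0 (λ _ → [])
  []ᵉ ()

  infixr 5 _∷ᵉ_
  _∷ᵉ_ : ∀ {p m} {f : Vec ℕ p → ℕ} {F : Vec ℕ p → Vec ℕ m} →
         Elementary p f → Elementaryⱽ p m F → Elementaryⱽ p (suc m) (λ v → f v ∷ F v)
  (ef ∷ᵉ eF) zero    = ef
  (ef ∷ᵉ eF) (suc i) = eF i

  elementary-id : ∀ {p} → Elementaryⱽ p p (λ v → v)
  elementary-id = elementary-lookup

  elementary-head : ∀ {p} → Elementary (suc p) head
  elementary-head = Elementary-resp-≗ (λ { (x ∷ v) → refl }) (elementary-lookup zero)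

  elementary-tail : ∀ {p} → Elementaryⱽ (suc p) p tail
  elementary-tail i = Elementary-resp-≗ (λ { (x ∷ v) → refl }) (elementary-lookup (suc i))

  elementary-∘tail : ∀ {p} {f : Vec ℕ p → ℕ} → Elementary p f → Elementary (suc p) (f ∘ tail)
  elementary-∘tail ef = elementary-∘ ef elementary-tail

  elementary-op₂ : ∀ {p} {_∙_ : ℕ → ℕ → ℕ} →
                   Elementary 2 (λ v → lookup v zero ∙ lookup v (suc zero)) →
                   {f g : Vec ℕ p → ℕ} → Elementary p f → Elementary p g →
                   Elementary p (λ v → f v ∙ g v)
  elementary-op₂ e∙ {f} {g} ef eg = elementary-∘ {F = λ v → f v ∷ g v ∷ []} e∙ (ef ∷ᵉ eg ∷ᵉ []ᵉ)

  elementary-+ : ∀ {p} {f g : Vec ℕ p → ℕ} → Elementary p f → Elementary p g →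
                 Elementary p (λ v → f v + g v)
  elementary-+ = elementary-op₂ (addF , λ { (a ∷ b ∷ []) → refl })

  elementary-∸ : ∀ {p} {f g : Vec ℕ p → ℕ} → Elementary p f → Elementary p g →
                 Elementary p (λ v → f v ∸ g v)
  elementary-∸ = elementary-op₂ (monus , λ { (a ∷ b ∷ []) → refl })

  sumTo≡∑< : ∀ f n → sumTo f n ≡ ∑< f (suc n)
  sumTo≡∑< f zero    = refl
  sumTo≡∑< f (suc n) = cong (_+ f (suc n)) (sumTo≡∑< f n)

  prodTo≡∏< : ∀ f n → prodTo f n ≡ ∏< f (suc n)
  prodTo≡∏< f zero    = sym (ℕ.*-identityˡ (f 0))
  prodTo≡∏< f (suc n) = cong (_* f (suc n)) (prodTo≡∏< f n)

  elementary-∑≤ : ∀ {p} {g : Vec ℕ (suc p) → ℕ} {h : Vec ℕ p → ℕ} →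
                  Elementary (suc p) g → Elementary p h →
                  Elementary p (λ v → ∑< (λ z → g (z ∷ v)) (suc (h v)))
  elementary-∑≤ {h = h} (e , e≗g) eh =
    Elementary-resp-≗ (λ v → trans (sumTo≡∑< _ (h v)) (∑<-cong (λ z → e≗g (z ∷ v)) (suc (h v))))
      (elementary-∘ {h = λ w → sumTo (λ z → ⟦ e ⟧ (z ∷ tail w)) (head w)} {F = λ v → h v ∷ v}
                    (bsum e , λ { (x ∷ v) → refl }) (eh ∷ᵉ elementary-id))

  elementary-∏≤ : ∀ {p} {g : Vec ℕ (suc p) → ℕ} {h : Vec ℕ p → ℕ} →
                  Elementary (suc p) g → Elementary p h →
                  Elementary p (λ v → ∏< (λ z → g (z ∷ v)) (suc (h v)))
  elementary-∏≤ {h = h} (e , e≗g) eh =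
    Elementary-resp-≗ (λ v → trans (prodTo≡∏< _ (h v)) (∏<-cong (λ z → e≗g (z ∷ v)) (suc (h v))))
      (elementary-∘ {h = λ w → prodTo (λ z → ⟦ e ⟧ (z ∷ tail w)) (head w)} {F = λ v → h v ∷ v}
                    (bprod e , λ { (x ∷ v) → refl }) (eh ∷ᵉ elementary-id))

  elementary-∑< : ∀ {p} {g : Vec ℕ (suc p) → ℕ} {h : Vec ℕ p → ℕ} →
                  Elementary (suc p) g → Elementary p h →
                  Elementary p (λ v → ∑< (λ z → g (z ∷ v)) (h v))
  elementary-∑< {g = g} {h} eg eh =
    Elementary-resp-≗ (λ v → ℕ.m+n∸n≡m (∑< (λ z → g (z ∷ v)) (h v)) (g (h v ∷ v)))
      (elementary-∸ (elementary-∑≤ eg eh) (elementary-∘ eg (eh ∷ᵉ elementary-id)))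

  ∑<-const : ∀ c n → ∑< (λ _ → c) n ≡ n * c
  ∑<-const c zero    = refl
  ∑<-const c (suc n) = trans (cong (_+ c) (∑<-const c n)) (ℕ.+-comm (n * c) c)

  elementary-* : ∀ {p} {f g : Vec ℕ p → ℕ} → Elementary p f → Elementary p g →
                 Elementary p (λ v → f v * g v)
  elementary-* {f = f} {g} ef eg =
    Elementary-resp-≗ (λ v → ∑<-const (g v) (f v)) (elementary-∑< (elementary-∘tail eg) ef)

  ∏<-by-cases : ∀ f n → ∏< f n ≡ (1 ∸ n) + (1 ∸ (1 ∸ n)) * ∏< f (suc (n ∸ 1))
  ∏<-by-cases f zero    = refl
  ∏<-by-cases f (suc n) rewrite ℕ.0∸n≡0 n = sym (ℕ.+-identityʳ (∏< f (suc n)))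

  elementary-∏< : ∀ {p} {g : Vec ℕ (suc p) → ℕ} {h : Vec ℕ p → ℕ} →
                  Elementary (suc p) g → Elementary p h →
                  Elementary p (λ v → ∏< (λ z → g (z ∷ v)) (h v))
  elementary-∏< {h = h} eg eh =
    Elementary-resp-≗ (λ v → sym (∏<-by-cases _ (h v)))
      (elementary-+ (elementary-∸ (elementary-const 1) eh)
                    (elementary-* (elementary-∸ (elementary-const 1) (elementary-∸ (elementary-const 1) eh))
                                  (elementary-∏≤ eg (elementary-∸ eh (elementary-const 1)))))

  χ≤ : ℕ → ℕ → ℕ
  χ≤ m n = 1 ∸ (m ∸ n)

  χ≤-≤ : ∀ {m n} → m ≤ n → χ≤ m n ≡ 1
  χ≤-≤ m≤n = cong (1 ∸_) (ℕ.m≤n⇒m∸n≡0 m≤n)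

  χ≤-> : ∀ {m n} → n < m → χ≤ m n ≡ 0
  χ≤-> n<m = ℕ.m≤n⇒m∸n≡0 (ℕ.m<n⇒0<n∸m n<m)

  elementary-χ≤ : ∀ {p} {f g : Vec ℕ p → ℕ} → Elementary p f → Elementary p g →
                  Elementary p (λ v → χ≤ (f v) (g v))
  elementary-χ≤ ef eg = elementary-∸ (elementary-const 1) (elementary-∸ ef eg)

  ∑<-χ≤ : ∀ q m → ∑< (λ z → χ≤ (suc z) q) m ≡ m ⊓ q
  ∑<-χ≤ q zero    = refl
  ∑<-χ≤ q (suc m) with suc m ≤? q
  ... | yes m<q = begin
    ∑< (λ z → χ≤ (suc z) q) m + χ≤ (suc m) q   ≡⟨ cong₂ _+_ (∑<-χ≤ q m) (χ≤-≤ m<q) ⟩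
    m ⊓ q + 1                                  ≡⟨ cong (_+ 1) (ℕ.m≤n⇒m⊓n≡m (ℕ.<⇒≤ m<q)) ⟩
    m + 1                                      ≡⟨ ℕ.+-comm m 1 ⟩
    suc m                                      ≡⟨ ℕ.m≤n⇒m⊓n≡m m<q ⟨
    suc m ⊓ q                                  ∎
    where open ≡-Reasoning
  ... | no m≮q = begin
    ∑< (λ z → χ≤ (suc z) q) m + χ≤ (suc m) q   ≡⟨ cong₂ _+_ (∑<-χ≤ q m) (χ≤-> (ℕ.≰⇒> m≮q)) ⟩
    m ⊓ q + 0                                  ≡⟨ ℕ.+-identityʳ (m ⊓ q) ⟩
    m ⊓ q                                      ≡⟨ ℕ.m≥n⇒m⊓n≡n (ℕ.≮⇒≥ m≮q) ⟩
    q                                          ≡⟨ ℕ.m≥n⇒m⊓n≡n (ℕ.≤-trans (ℕ.≮⇒≥ m≮q) (ℕ.n≤1+n m)) ⟨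
    suc m ⊓ q                                  ∎
    where open ≡-Reasoning

  module _ {d : ℕ} .{{_ : NonZero d}} where

    *-≤⇒≤-/ : ∀ {m n} → m * d ≤ n → m ≤ n / d
    *-≤⇒≤-/ {m} {n} md≤n = subst (_≤ n / d) (m*n/n≡m m d) (/-monoˡ-≤ d md≤n)

    ≤-/⇒*-≤ : ∀ {m n} → m ≤ n / d → m * d ≤ n
    ≤-/⇒*-≤ {m} {n} m≤n/d = ℕ.≤-trans (ℕ.*-monoˡ-≤ d m≤n/d) (m/n*n≤m n d)

    χ≤-*-/ : ∀ m n → χ≤ (m * d) n ≡ χ≤ m (n / d)
    χ≤-*-/ m n with m ≤? n / d
    ... | yes m≤n/d = trans (χ≤-≤ (≤-/⇒*-≤ m≤n/d)) (sym (χ≤-≤ m≤n/d))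
    ... | no  m≰n/d = trans (χ≤-> (ℕ.≰⇒> (m≰n/d ∘ *-≤⇒≤-/))) (sym (χ≤-> (ℕ.≰⇒> m≰n/d)))

    /-as-∑< : ∀ n → n / d ≡ ∑< (λ z → χ≤ (suc z * d) n) n
    /-as-∑< n = sym (begin
      ∑< (λ z → χ≤ (suc z * d) n) n    ≡⟨ ∑<-cong (λ z → χ≤-*-/ (suc z) n) n ⟩
      ∑< (λ z → χ≤ (suc z) (n / d)) n  ≡⟨ ∑<-χ≤ (n / d) n ⟩
      n ⊓ (n / d)                      ≡⟨ ℕ.m≥n⇒m⊓n≡n (m/n≤m n d) ⟩
      n / d                            ∎)
      where open ≡-Reasoning

  elementary-/ : ∀ {p} {f d : Vec ℕ p → ℕ} → Elementary p f → Elementary p d →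
                 (d≢0 : ∀ v → NonZero (d v)) → Elementary p (λ v → (f v / d v) {{d≢0 v}})
  elementary-/ {f = f} {d} ef ed d≢0 =
    Elementary-resp-≗ (λ v → sym (/-as-∑< {{d≢0 v}} (f v)))
      (elementary-∑< (elementary-χ≤ (elementary-* (elementary-+ (elementary-const 1) (elementary-lookup zero))
                                                  (elementary-∘tail ed))
                                    (elementary-∘tail ef))
                     ef)

  elementary-% : ∀ {p} {f d : Vec ℕ p → ℕ} → Elementary p f → Elementary p d →
                 (d≢0 : ∀ v → NonZero (d v)) → Elementary p (λ v → (f v % d v) {{d≢0 v}})
  elementary-% {f = f} {d} ef ed d≢0 =
    Elementary-resp-≗ (λ v → sym (m%n≡m∸m/n*n (f v) (d v) {{d≢0 v}}))
      (elementary-∸ ef (elementary-* (elementary-/ ef ed d≢0) ed))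

  ∏<-const : ∀ c n → ∏< (λ _ → c) n ≡ c ^ n
  ∏<-const c zero    = refl
  ∏<-const c (suc n) = trans (cong (_* c) (∏<-const c n)) (ℕ.*-comm (c ^ n) c)

  elementary-^ : ∀ {p} c {f : Vec ℕ p → ℕ} → Elementary p f → Elementary p (λ v → c ^ f v)
  elementary-^ c {f} ef = Elementary-resp-≗ (λ v → ∏<-const c (f v)) (elementary-∏< (elementary-const c) ef)

  select : ∀ {K} → (Fin (suc K) → ℕ) → ℕ → ℕ
  select {zero}  h d = h zero
  select {suc K} h d = (1 ∸ d) * h zero + (1 ∸ (1 ∸ d)) * select (h ∘ suc) (d ∸ 1)

  select-toℕ : ∀ {K} (h : Fin (suc K) → ℕ) a → select h (toℕ a) ≡ h a
  select-toℕ {zero}  h zero    = refl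
  select-toℕ {suc K} h zero    = trans (ℕ.+-identityʳ (h zero + 0)) (ℕ.+-identityʳ (h zero))
  select-toℕ {suc K} h (suc a) rewrite ℕ.0∸n≡0 (toℕ a) = trans (ℕ.+-identityʳ _) (select-toℕ (h ∘ suc) a)

  elementary-select : ∀ {p K} (h : Fin (suc K) → Vec ℕ p → ℕ) {d : Vec ℕ p → ℕ} →
                      (∀ a → Elementary p (h a)) → Elementary p d →
                      Elementary p (λ v → select (λ a → h a v) (d v))
  elementary-select {K = zero}  h eh ed = eh zero
  elementary-select {K = suc K} h eh ed =
    elementary-+ (elementary-* (elementary-∸ (elementary-const 1) ed) (eh zero))
                 (elementary-* (elementary-∸ (elementary-const 1) (elementary-∸ (elementary-const 1) ed))
                               (elementary-select (h ∘ suc) (eh ∘ suc) (elementary-∸ ed (elementary-const 1))))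

  elementary-at-mod : ∀ {p K} (h : Fin (suc K) → Vec ℕ p → ℕ) {d : Vec ℕ p → ℕ} →
                   (∀ a → Elementary p (h a)) → Elementary p d →
                   Elementary p (λ v → h (d v mod suc K) v)
  elementary-at-mod {K = K} h {d} eh ed =
    Elementary-resp-≗ (λ v → trans (cong (select (λ a → h a v)) (sym (toℕ-fromℕ< _))) (select-toℕ _ (d v mod suc K)))
      (elementary-select h eh (elementary-% ed (elementary-const (suc K)) (λ _ → _)))

open ElementaryClosure

module SignMagnitude where
  open import Data.Nat using (_∸_; _<_; s≤s)
  open import Data.Nat.DivMod using (_%_)
  open import Data.Integer using (_+_; _*_; -_; _⊖_; -1ℤ; _^_; ∣_∣)
  open import Data.Integer.Tactic.RingSolver using (solve-∀)

  ElementaryZ-resp-≗ : ∀ {p} {f g : Vec ℕ p → ℤ} → f ≗ g → ElementaryZ p f → ElementaryZ p g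
  ElementaryZ-resp-≗ f≗g (ef± , ef∣∣) =
    Elementary-resp-≗ (cong sgnBit ∘ f≗g) ef± , Elementary-resp-≗ (cong ∣_∣ ∘ f≗g) ef∣∣

  elementaryZ-const : ∀ {p} c → ElementaryZ p (λ _ → c)
  elementaryZ-const c = elementary-const (sgnBit c) , elementary-const ∣ c ∣

  sgnBit-⊖ : ∀ m n → sgnBit (m ⊖ n) ≡ χ≤ (suc m) n
  sgnBit-⊖ m n with m ℕ.<? n
  ... | yes m<n rewrite ℤ.⊖-< m<n | χ≤-≤ m<n = sgnBit-neg (ℕ.m<n⇒0<n∸m m<n)
    where sgnBit-neg : ∀ {k} → 0 < k → sgnBit (- + k) ≡ 1
          sgnBit-neg {suc k} _ = refl
  ... | no m≮n rewrite ℤ.⊖-≥ (ℕ.≮⇒≥ m≮n) = sym (χ≤-> (s≤s (ℕ.≮⇒≥ m≮n)))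

  ∣⊖∣ : ∀ m n → ∣ m ⊖ n ∣ ≡ (m ∸ n) ℕ.+ (n ∸ m)
  ∣⊖∣ m n with m ℕ.<? n
  ... | yes m<n rewrite ℤ.∣⊖∣-< m<n | ℕ.m≤n⇒m∸n≡0 (ℕ.<⇒≤ m<n) = refl
  ... | no m≮n rewrite ℤ.⊖-≥ (ℕ.≮⇒≥ m≮n) | ℕ.m≤n⇒m∸n≡0 (ℕ.≮⇒≥ m≮n) = sym (ℕ.+-identityʳ (m ∸ n))

  elementaryZ-⊖ : ∀ {p} {P N : Vec ℕ p → ℕ} → Elementary p P → Elementary p N →
                  ElementaryZ p (λ v → P v ⊖ N v)
  elementaryZ-⊖ {P = P} {N} eP eN =
    Elementary-resp-≗ (λ v → sym (sgnBit-⊖ (P v) (N v))) (elementary-χ≤ (elementary-+ (elementary-const 1) eP) eN) ,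
    Elementary-resp-≗ (λ v → sym (∣⊖∣ (P v) (N v))) (elementary-+ (elementary-∸ eP eN) (elementary-∸ eN eP))

  ⊖-+-⊖ : ∀ a b c d → (a ⊖ b) + (c ⊖ d) ≡ (a ℕ.+ c) ⊖ (b ℕ.+ d)
  ⊖-+-⊖ a b c d = begin
    (a ⊖ b) + (c ⊖ d)                    ≡⟨ cong₂ _+_ (ℤ.m-n≡m⊖n a b) (ℤ.m-n≡m⊖n c d) ⟨
    (+ a + - + b) + (+ c + - + d)        ≡⟨ regroup (+ a) (+ b) (+ c) (+ d) ⟩
    (+ a + + c) + - (+ b + + d)          ≡⟨ cong₂ (λ x y → x + - y) (ℤ.pos-+ a c) (ℤ.pos-+ b d) ⟨
    + (a ℕ.+ c) + - + (b ℕ.+ d)          ≡⟨ ℤ.m-n≡m⊖n (a ℕ.+ c) (b ℕ.+ d) ⟩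
    (a ℕ.+ c) ⊖ (b ℕ.+ d)                ∎
    where
    open ≡-Reasoning
    regroup : ∀ a b c d → (a + - b) + (c + - d) ≡ (a + c) + - (b + d)
    regroup = solve-∀

  positivePart negativePart : ℤ → ℕ
  positivePart z = (1 ∸ sgnBit z) ℕ.* ∣ z ∣
  negativePart z = sgnBit z ℕ.* ∣ z ∣

  ⊖-parts : ∀ z → z ≡ positivePart z ⊖ negativePart z
  ⊖-parts (+ n)    = sym (trans (ℤ.⊖-≥ ℕ.z≤n) (cong +_ (ℕ.+-identityʳ n)))
  ⊖-parts -[1+ n ] = sym (trans (ℤ.⊖-≤ ℕ.z≤n) (cong (-_ ∘ +_) (ℕ.+-identityʳ (suc n))))

  +-parts : ∀ x y → x + y ≡ (positivePart x ℕ.+ positivePart y) ⊖ (negativePart x ℕ.+ negativePart y)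
  +-parts x y = trans (cong₂ _+_ (⊖-parts x) (⊖-parts y))
                      (⊖-+-⊖ (positivePart x) (negativePart x) (positivePart y) (negativePart y))

  elementary-positivePart : ∀ {p} {f : Vec ℕ p → ℤ} → ElementaryZ p f → Elementary p (positivePart ∘ f)
  elementary-positivePart (ef± , ef∣∣) = elementary-* (elementary-∸ (elementary-const 1) ef±) ef∣∣

  elementary-negativePart : ∀ {p} {f : Vec ℕ p → ℤ} → ElementaryZ p f → Elementary p (negativePart ∘ f)
  elementary-negativePart (ef± , ef∣∣) = elementary-* ef± ef∣∣

  elementaryZ-+ : ∀ {p} {f g : Vec ℕ p → ℤ} → ElementaryZ p f → ElementaryZ p g →
                  ElementaryZ p (λ v → f v + g v)
  elementaryZ-+ {f = f} {g} ef eg =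
    ElementaryZ-resp-≗ (λ v → sym (+-parts (f v) (g v)))
      (elementaryZ-⊖ (elementary-+ (elementary-positivePart ef) (elementary-positivePart eg))
                     (elementary-+ (elementary-negativePart ef) (elementary-negativePart eg)))

  signed : ℕ → ℕ → ℤ
  signed σ μ = -1ℤ ^ σ * + μ

  signed-⊖ : ∀ σ μ → signed σ μ ≡ ((1 ∸ σ % 2) ℕ.* μ) ⊖ ((σ % 2) ℕ.* μ)
  signed-⊖ zero          μ = trans (ℤ.*-identityˡ (+ μ)) (sym (trans (ℤ.⊖-≥ ℕ.z≤n) (cong +_ (ℕ.+-identityʳ μ))))
  signed-⊖ (suc zero)    μ = trans (ℤ.-1*i≡-i (+ μ)) (sym (trans (ℤ.⊖-≤ ℕ.z≤n) (cong (-_ ∘ +_) (ℕ.+-identityʳ μ))))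
  signed-⊖ (suc (suc σ)) μ = trans (cong (_* + μ) -1²) (signed-⊖ σ μ)
    where
    -1² : -1ℤ * (-1ℤ * -1ℤ ^ σ) ≡ -1ℤ ^ σ
    -1² = trans (ℤ.-1*i≡-i _) (trans (cong -_ (ℤ.-1*i≡-i _)) (ℤ.neg-involutive _))

  signed-sgnBit : ∀ z → signed (sgnBit z) ∣ z ∣ ≡ z
  signed-sgnBit (+ n)    = ℤ.*-identityˡ (+ n)
  signed-sgnBit -[1+ n ] = ℤ.-1*i≡-i (+ suc n)

  signed-* : ∀ a m b n → signed a m * signed b n ≡ signed (a ℕ.+ b) (m ℕ.* n)
  signed-* a m b n = begin
    (-1ℤ ^ a * + m) * (-1ℤ ^ b * + n)     ≡⟨ regroup (-1ℤ ^ a) (+ m) (-1ℤ ^ b) (+ n) ⟩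
    (-1ℤ ^ a * -1ℤ ^ b) * (+ m * + n)     ≡⟨ cong₂ _*_ (ℤ.^-distribˡ-+-* -1ℤ a b) (ℤ.pos-* m n) ⟨
    -1ℤ ^ (a ℕ.+ b) * + (m ℕ.* n)         ∎
    where
    open ≡-Reasoning
    regroup : ∀ x m y n → (x * m) * (y * n) ≡ (x * y) * (m * n)
    regroup = solve-∀

  ∏<ℤ-signed : ∀ z n → ∏<ℤ z n ≡ signed (∑< (sgnBit ∘ z) n) (∏< (∣_∣ ∘ z) n)
  ∏<ℤ-signed z zero    = refl
  ∏<ℤ-signed z (suc n) =
    trans (cong₂ _*_ (∏<ℤ-signed z n) (sym (signed-sgnBit (z n))))
          (signed-* (∑< (sgnBit ∘ z) n) (∏< (∣_∣ ∘ z) n) (sgnBit (z n)) ∣ z n ∣)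

  ∑<ℤ-signed : ∀ (σ μ : ℕ → ℕ) n → ∑<ℤ (λ s → signed (σ s) (μ s)) n
                         ≡ ∑< (λ s → (1 ∸ σ s % 2) ℕ.* μ s) n ⊖ ∑< (λ s → (σ s % 2) ℕ.* μ s) n
  ∑<ℤ-signed σ μ zero    = refl
  ∑<ℤ-signed σ μ (suc n) =
    trans (cong₂ _+_ (∑<ℤ-signed σ μ n) (signed-⊖ (σ n) (μ n))) (⊖-+-⊖ (∑< pos n) (∑< neg n) (pos n) (neg n))
    where
    pos neg : ℕ → ℕ
    pos s = (1 ∸ σ s % 2) ℕ.* μ s
    neg s = (σ s % 2) ℕ.* μ s

open SignMagnitude

module FiniteSums where
  open import Data.Integer using (_+_; _*_)
  open import Data.Fin.Properties using (toℕ-inject₁; toℕ-fromℕ)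
  open import Algebra.Properties.Semiring.Sum ℤ.+-*-semiring
    using (sum; sum-cong-≗; sum-init-last; sum-replicate-zero; ∑-distrib-+)

  sumFin≡sum : ∀ {n} (f : Fin n → ℤ) → sumFin f ≡ sum f
  sumFin≡sum {zero}  f = refl
  sumFin≡sum {suc n} f = cong (λ t → f zero + t) (sumFin≡sum (f ∘ suc))

  ∑<ℤ≡sum : ∀ n (f : ℕ → ℤ) → ∑<ℤ f n ≡ sum (f ∘ toℕ {n})
  ∑<ℤ≡sum zero    f = refl
  ∑<ℤ≡sum (suc n) f = begin
    ∑<ℤ f n + f n
      ≡⟨ cong₂ _+_ (∑<ℤ≡sum n f) (cong f (sym (toℕ-fromℕ n))) ⟩
    sum {n} (f ∘ toℕ) + f (toℕ (Fin.fromℕ n))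
      ≡⟨ cong (_+ f (toℕ (Fin.fromℕ n))) (sum-cong-≗ {n} (cong f ∘ sym ∘ toℕ-inject₁)) ⟩
    sum {n} (f ∘ toℕ ∘ Fin.inject₁) + f (toℕ (Fin.fromℕ n))
      ≡⟨ sum-init-last {n} (f ∘ toℕ) ⟨
    sum {suc n} (f ∘ toℕ)
      ∎
    where open ≡-Reasoning

  ∑<ℤ-*ˡ : ∀ c (f : ℕ → ℤ) n → c * ∑<ℤ f n ≡ ∑<ℤ (λ s → c * f s) n
  ∑<ℤ-*ˡ c f zero    = ℤ.*-zeroʳ c
  ∑<ℤ-*ˡ c f (suc n) = trans (ℤ.*-distribˡ-+ c (∑<ℤ f n) (f n)) (cong (_+ c * f n) (∑<ℤ-*ˡ c f n))

  ∑<ℤ-sum-comm : ∀ {m} (f : ℕ → Fin m → ℤ) n →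
                 ∑<ℤ (λ s → sum (f s)) n ≡ sum (λ b → ∑<ℤ (λ s → f s b) n)
  ∑<ℤ-sum-comm {m} f zero = sym (sum-replicate-zero m)
  ∑<ℤ-sum-comm f (suc n) =
    trans (cong (_+ sum (f n)) (∑<ℤ-sum-comm f n)) (sym (∑-distrib-+ (λ b → ∑<ℤ (λ s → f s b) n) (f n)))

  δ : ∀ {n} → Fin n → Fin n → ℤ
  δ zero    zero    = + 1
  δ zero    (suc j) = + 0
  δ (suc i) zero    = + 0
  δ (suc i) (suc j) = δ i j

  sum-δ : ∀ {n} (i : Fin n) (h : Fin n → ℤ) → sum (λ j → δ i j * h j) ≡ h i
  sum-δ {suc n} zero h = trans (cong₂ _+_ (ℤ.*-identityˡ (h zero)) (sum-replicate-zero n)) (ℤ.+-identityʳ (h zero))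
  sum-δ {suc n} (suc i) h = trans (ℤ.+-identityˡ _) (sum-δ i (h ∘ suc))

  sumFin-δ+ : ∀ {n} (i : Fin n) (a s : Fin n → ℤ) →
              sumFin (λ j → (δ i j + a j) * s j) ≡ s i + sumFin (λ j → a j * s j)
  sumFin-δ+ i a s = begin
    sumFin (λ j → (δ i j + a j) * s j)                   ≡⟨ sumFin≡sum (λ j → (δ i j + a j) * s j) ⟩
    sum (λ j → (δ i j + a j) * s j)                      ≡⟨ sum-cong-≗ (λ j → ℤ.*-distribʳ-+ (s j) (δ i j) (a j)) ⟩
    sum (λ j → δ i j * s j + a j * s j)                  ≡⟨ ∑-distrib-+ (λ j → δ i j * s j) (λ j → a j * s j) ⟩
    sum (λ j → δ i j * s j) + sum (λ j → a j * s j)      ≡⟨ cong₂ _+_ (sum-δ i s) (sym (sumFin≡sum (λ j → a j * s j))) ⟩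
    s i + sumFin (λ j → a j * s j)                       ∎
    where open ≡-Reasoning

  sumFin-cong : ∀ {n} {f g : Fin n → ℤ} → f ≗ g → sumFin f ≡ sumFin g
  sumFin-cong {f = f} {g} f≗g = trans (sumFin≡sum f) (trans (sum-cong-≗ f≗g) (sym (sumFin≡sum g)))

open FiniteSums

module LinearRecurrence {p k : ℕ} (G : Vec ℕ p → Fin k → ℕ)
         (A : Vec ℕ (suc p) → Fin k → Fin k → ℤ) (B : Vec ℕ (suc p) → Fin k → ℤ) where
  open import Data.Nat using (_∸_; _^_)
  open import Data.Nat.DivMod
    using (_/_; _%_; _mod_; %-remove-+ˡ; m<n⇒m%n≡m; +-distrib-/-∣ˡ; m*n/n≡m; m<n⇒m/n≡0; n/1≡n; m/n/o≡m/[n*o])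
  open import Data.Nat.Divisibility using (divides)
  open import Data.Fin.Properties using (toℕ-injective; toℕ-fromℕ<; toℕ<n)
  open import Data.Integer using (_+_; _*_; _⊖_; ∣_∣)
  open import Data.Integer.Tactic.RingSolver using (solve-∀)
  open import Algebra.Properties.Semiring.Sum ℤ.+-*-semiring using (sum; sum-cong-≗; sum-replicate-zero)

  K : ℕ
  K = suc k

  M : Vec ℕ (suc p) → Fin K → Fin K → ℤ
  M w zero    zero    = + 1
  M w zero    (suc j) = + 0
  M w (suc i) zero    = B w i
  M w (suc i) (suc j) = δ i j + A w i j

  initial : Vec ℕ p → Fin K → ℤ
  initial y zero    = + 1
  initial y (suc i) = + G y i

  state : ℕ → Vec ℕ p → Fin K → ℤ
  state zero    y a = initial y a
  state (suc x) y a = sumFin (λ b → M (x ∷ y) a b * state x y b)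

  state-zero : ∀ x y → state x y zero ≡ + 1
  state-zero zero    y = refl
  state-zero (suc x) y rewrite state-zero x y =
    cong (λ t → + 1 + t) (trans (sumFin≡sum {k} (λ _ → + 0)) (sum-replicate-zero k))

  state-suc : ∀ x y i → state x y (suc i) ≡ solution p k G A B x y i
  state-suc zero    y i = refl
  state-suc (suc x) y i = begin
    B w i * state x y zero + sumFin (λ j → (δ i j + A w i j) * state x y (suc j))
      ≡⟨ cong₂ _+_ (cong (B w i *_) (state-zero x y)) (sumFin-cong λ j → cong ((δ i j + A w i j) *_) (state-suc x y j)) ⟩
    B w i * + 1 + sumFin (λ j → (δ i j + A w i j) * f j)
      ≡⟨ cong (λ t → B w i * + 1 + t) (sumFin-δ+ i (A w i) f) ⟩
    B w i * + 1 + (f i + sumFin (λ j → A w i j * f j))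
      ≡⟨ regroup (B w i) (f i) (sumFin (λ j → A w i j * f j)) ⟩
    f i + (sumFin (λ j → A w i j * f j) + B w i)
      ∎
    where
    open ≡-Reasoning
    w = x ∷ y
    f = solution p k G A B x y
    regroup : ∀ b s t → b * + 1 + (s + t) ≡ s + (t + b)
    regroup = solve-∀

  digit : ℕ → ℕ → Fin K
  digit zero    n = n mod K
  digit (suc m) n = digit m (n / K)

  digit-zero : ∀ s a → digit 0 (s ℕ.* K ℕ.+ toℕ a) ≡ a
  digit-zero s a = toℕ-injective (begin
    toℕ ((s ℕ.* K ℕ.+ toℕ a) mod K) ≡⟨ toℕ-fromℕ< _ ⟩
    (s ℕ.* K ℕ.+ toℕ a) % K         ≡⟨ %-remove-+ˡ (toℕ a) (divides s refl) ⟩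
    toℕ a % K                       ≡⟨ m<n⇒m%n≡m (toℕ<n a) ⟩
    toℕ a                           ∎)
    where open ≡-Reasoning

  digit-suc : ∀ m s a → digit (suc m) (s ℕ.* K ℕ.+ toℕ a) ≡ digit m s
  digit-suc m s a = cong (digit m) (begin
    (s ℕ.* K ℕ.+ toℕ a) / K   ≡⟨ +-distrib-/-∣ˡ (toℕ a) (divides s refl) ⟩
    s ℕ.* K / K ℕ.+ toℕ a / K ≡⟨ cong₂ ℕ._+_ (m*n/n≡m s K) (m<n⇒m/n≡0 (toℕ<n a)) ⟩
    s ℕ.+ 0                   ≡⟨ ℕ.+-identityʳ s ⟩
    s                         ∎)
    where open ≡-Reasoning

  _/K^_ : ℕ → ℕ → ℕ
  n /K^ m = (n / K ^ m) {{ℕ.m^n≢0 K m}}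

  digit-closed : ∀ m n → digit m n ≡ (n /K^ m) mod K
  digit-closed zero    n = cong (_mod K) (sym (n/1≡n n))
  digit-closed (suc m) n = trans (digit-closed m (n / K))
    (cong (_mod K) (m/n/o≡m/[n*o] n K (K ^ m) {{_}} {{ℕ.m^n≢0 K m}} {{ℕ.m^n≢0 K (suc m)}}))

  step : ℕ → Vec ℕ p → ℕ → ℕ → ℤ
  step x y n m = M ((x ∸ suc m) ∷ y) (digit m n) (digit (suc m) n)

  -- n codes the path visiting digit m n at time x − m; its weight is the product of the entries
  -- of M met along it and of the initial entry it starts from.
  pathWeight : ℕ → Vec ℕ p → ℕ → ℤ
  pathWeight x y n = ∏<ℤ (step x y n) x * initial y (digit x n)

  pathWeight-suc : ∀ x y s a →
                   pathWeight (suc x) y (s ℕ.* K ℕ.+ toℕ a) ≡ M (x ∷ y) a (digit 0 s) * pathWeight x y s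
  pathWeight-suc x y s a = begin
    ∏<ℤ (step (suc x) y n) (suc x) * initial y (digit (suc x) n)
      ≡⟨ cong₂ _*_ (∏<ℤ-front (step (suc x) y n) x) (cong (initial y) (digit-suc x s a)) ⟩
    (step (suc x) y n 0 * ∏<ℤ (step (suc x) y n ∘ suc) x) * initial y (digit x s)
      ≡⟨ cong₂ (λ u v → (u * v) * initial y (digit x s)) first (∏<ℤ-cong later x) ⟩
    (M (x ∷ y) a (digit 0 s) * ∏<ℤ (step x y s) x) * initial y (digit x s)
      ≡⟨ ℤ.*-assoc (M (x ∷ y) a (digit 0 s)) _ _ ⟩
    M (x ∷ y) a (digit 0 s) * pathWeight x y s
      ∎
    where
    open ≡-Reasoning
    n = s ℕ.* K ℕ.+ toℕ a
    first : step (suc x) y n 0 ≡ M (x ∷ y) a (digit 0 s)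
    first = cong₂ (M (x ∷ y)) (digit-zero s a) (digit-suc 0 s a)
    later : ∀ m → step (suc x) y n (suc m) ≡ step x y s m
    later m = cong₂ (M ((x ∸ suc m) ∷ y)) (digit-suc m s a) (digit-suc (suc m) s a)

  state-as-paths : ∀ x y a → state x y a ≡ ∑<ℤ (λ s → pathWeight x y (s ℕ.* K ℕ.+ toℕ a)) (K ^ x)
  state-as-paths zero    y a =
    sym (trans (ℤ.+-identityˡ _) (trans (ℤ.*-identityˡ _) (cong (initial y) (digit-zero 0 a))))
  state-as-paths (suc x) y a = begin
    sumFin (λ b → M w a b * state x y b)
      ≡⟨ sumFin-cong (λ b → cong (M w a b *_) (state-as-paths x y b)) ⟩
    sumFin (λ b → M w a b * ∑<ℤ (V b) N)
      ≡⟨ sumFin≡sum (λ b → M w a b * ∑<ℤ (V b) N) ⟩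
    sum (λ b → M w a b * ∑<ℤ (V b) N)
      ≡⟨ sum-cong-≗ (λ b → ∑<ℤ-*ˡ (M w a b) (V b) N) ⟩
    sum (λ b → ∑<ℤ (λ s → M w a b * V b s) N)
      ≡⟨ ∑<ℤ-sum-comm (λ s b → M w a b * V b s) N ⟨
    ∑<ℤ (λ s → sum (λ b → M w a b * V b s)) N
      ≡⟨ ∑<ℤ-cong block N ⟩
    ∑<ℤ (λ s → ∑<ℤ (λ c → W (s ℕ.* K ℕ.+ c)) K) N
      ≡⟨ ∑<ℤ-* W N K ⟨
    ∑<ℤ W (N ℕ.* K)
      ≡⟨ cong (∑<ℤ W) (ℕ.*-comm N K) ⟩
    ∑<ℤ W (K ^ suc x)
      ∎
    where
    open ≡-Reasoning
    w = x ∷ y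
    N = K ^ x
    V : Fin K → ℕ → ℤ
    V b s = pathWeight x y (s ℕ.* K ℕ.+ toℕ b)
    W : ℕ → ℤ
    W n = pathWeight (suc x) y (n ℕ.* K ℕ.+ toℕ a)
    block : ∀ s → sum (λ b → M w a b * V b s) ≡ ∑<ℤ (λ c → W (s ℕ.* K ℕ.+ c)) K
    block s = sym (trans (∑<ℤ≡sum K (λ c → W (s ℕ.* K ℕ.+ c))) (sum-cong-≗ λ b →
      trans (pathWeight-suc x y (s ℕ.* K ℕ.+ toℕ b) a) (cong (λ c → M w a c * V b s) (digit-zero s b))))

  pathSign pathSize : ℕ → Vec ℕ p → ℕ → ℕ
  pathSign x y n = ∑< (sgnBit ∘ step x y n) x ℕ.+ sgnBit (initial y (digit x n))
  pathSize x y n = ∏< (∣_∣ ∘ step x y n) x ℕ.* ∣ initial y (digit x n) ∣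

  pathWeight-signed : ∀ x y n → pathWeight x y n ≡ signed (pathSign x y n) (pathSize x y n)
  pathWeight-signed x y n =
    trans (cong₂ _*_ (∏<ℤ-signed (step x y n) x) (sym (signed-sgnBit g)))
          (signed-* (∑< (sgnBit ∘ step x y n) x) (∏< (∣_∣ ∘ step x y n) x) (sgnBit g) ∣ g ∣)
    where g = initial y (digit x n)

  evenPaths oddPaths : ℕ → Vec ℕ p → ℕ → ℕ
  evenPaths x y c = ∑< (λ s → (1 ∸ pathSign x y (s ℕ.* K ℕ.+ c) % 2) ℕ.* pathSize x y (s ℕ.* K ℕ.+ c)) (K ^ x)
  oddPaths  x y c = ∑< (λ s → (pathSign x y (s ℕ.* K ℕ.+ c) % 2) ℕ.* pathSize x y (s ℕ.* K ℕ.+ c)) (K ^ x)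

  solution-as-⊖ : ∀ x y i →
                  solution p k G A B x y i ≡ evenPaths x y (suc (toℕ i)) ⊖ oddPaths x y (suc (toℕ i))
  solution-as-⊖ x y i = begin
    solution p k G A B x y i                                   ≡⟨ state-suc x y i ⟨
    state x y (suc i)                                          ≡⟨ state-as-paths x y (suc i) ⟩
    ∑<ℤ (λ s → pathWeight x y (code s)) (K ^ x)                ≡⟨ ∑<ℤ-cong (pathWeight-signed x y ∘ code) (K ^ x) ⟩
    ∑<ℤ (λ s → signed (σ s) (μ s)) (K ^ x)                     ≡⟨ ∑<ℤ-signed σ μ (K ^ x) ⟩
    evenPaths x y (suc (toℕ i)) ⊖ oddPaths x y (suc (toℕ i))   ∎
    where
    open ≡-Reasoning
    code σ μ : ℕ → ℕ
    code s = s ℕ.* K ℕ.+ suc (toℕ i)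
    σ = pathSign x y ∘ code
    μ = pathSize x y ∘ code

module ElementarySolution {p k : ℕ} {G : Vec ℕ p → Fin k → ℕ}
         {A : Vec ℕ (suc p) → Fin k → Fin k → ℤ} {B : Vec ℕ (suc p) → Fin k → ℤ}
         (eG : ElementaryVec p k G) (eA : ElementaryZMat (suc p) k A) (eB : ElementaryZVec (suc p) k B) where
  open LinearRecurrence G A B
  open import Data.Nat using (_∸_; _^_)
  open import Data.Nat.DivMod using (_%_)
  open import Data.Integer using (∣_∣)

  elementaryZ-M : ∀ a b → ElementaryZ (suc p) (λ w → M w a b)
  elementaryZ-M zero    zero    = elementaryZ-const (+ 1)
  elementaryZ-M zero    (suc j) = elementaryZ-const (+ 0)
  elementaryZ-M (suc i) zero    = eB i
  elementaryZ-M (suc i) (suc j) = elementaryZ-+ (elementaryZ-const (δ i j)) (eA i j)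

  elementaryZ-initial : ∀ a → ElementaryZ p (λ y → initial y a)
  elementaryZ-initial zero    = elementaryZ-const (+ 1)
  elementaryZ-initial (suc i) = elementary-const 0 , eG i

  elementary-at-digit : ∀ {q} (h : Fin K → Vec ℕ q → ℕ) → (∀ a → Elementary q (h a)) →
                        {fm fn : Vec ℕ q → ℕ} → Elementary q fm → Elementary q fn →
                        Elementary q (λ v → h (digit (fm v) (fn v)) v)
  elementary-at-digit h eh {fm} {fn} em en =
    Elementary-resp-≗ (λ v → cong (λ a → h a v) (sym (digit-closed (fm v) (fn v))))
      (elementary-at-mod h eh (elementary-/ en (elementary-^ K em) (λ v → ℕ.m^n≢0 K (fm v))))

  module _ (ε : ℤ → ℕ) {q : ℕ} {fx fn : Vec ℕ q → ℕ} {fy : Vec ℕ q → Vec ℕ p}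
           (ex : Elementary q fx) (ey : Elementaryⱽ q p fy) (en : Elementary q fn) where

    elementary-step : (∀ a b → Elementary (suc p) (λ w → ε (M w a b))) →
                      {fm : Vec ℕ q → ℕ} → Elementary q fm →
                      Elementary q (λ v → ε (step (fx v) (fy v) (fn v) (fm v)))
    elementary-step eM {fm} em =
      elementary-at-digit (λ a v → ε (M (t v ∷ fy v) a (digit (suc (fm v)) (fn v))))
        (λ a → elementary-at-digit (λ b v → ε (M (t v ∷ fy v) a b))
                 (λ b → elementary-∘ (eM a b) (et ∷ᵉ ey))
                 (elementary-+ (elementary-const 1) em) en)
        em en
      where
      t : Vec ℕ q → ℕ
      t v = fx v ∸ suc (fm v)
      et : Elementary q t
      et = elementary-∸ ex (elementary-+ (elementary-const 1) em)

    elementary-initial : (∀ a → Elementary p (λ y → ε (initial y a))) →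
                         Elementary q (λ v → ε (initial (fy v) (digit (fx v) (fn v))))
    elementary-initial eI = elementary-at-digit (λ a v → ε (initial (fy v) a)) (λ a → elementary-∘ (eI a) ey) ex en

  module _ {q : ℕ} {fx fn : Vec ℕ q → ℕ} {fy : Vec ℕ q → Vec ℕ p}
           (ex : Elementary q fx) (ey : Elementaryⱽ q p fy) (en : Elementary q fn) where

    private
      ex′ : Elementary (suc q) (fx ∘ tail)
      ex′ = elementary-∘tail ex
      ey′ : Elementaryⱽ (suc q) p (fy ∘ tail)
      ey′ = elementary-∘tail ∘ ey
      en′ : Elementary (suc q) (fn ∘ tail)
      en′ = elementary-∘tail en

    elementary-pathSign : Elementary q (λ v → pathSign (fx v) (fy v) (fn v))
    elementary-pathSign =
      elementary-+ (elementary-∑< (elementary-step sgnBit {fy = fy ∘ tail} ex′ ey′ en′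
                                      (λ a b → proj₁ (elementaryZ-M a b)) (elementary-lookup zero))
                                  ex)
                   (elementary-initial sgnBit ex ey en (proj₁ ∘ elementaryZ-initial))

    elementary-pathSize : Elementary q (λ v → pathSize (fx v) (fy v) (fn v))
    elementary-pathSize =
      elementary-* (elementary-∏< (elementary-step ∣_∣ {fy = fy ∘ tail} ex′ ey′ en′
                                      (λ a b → proj₂ (elementaryZ-M a b)) (elementary-lookup zero))
                                  ex)
                   (elementary-initial ∣_∣ ex ey en (proj₂ ∘ elementaryZ-initial))

  module _ (c : ℕ) where
    private
      code : Vec ℕ (suc (suc p)) → ℕ
      code v = head v ℕ.* K ℕ.+ c

      elementary-code : Elementary (suc (suc p)) code
      elementary-code = elementary-+ (elementary-* elementary-head (elementary-const K)) (elementary-const c)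

      ex : Elementary (suc (suc p)) (head ∘ tail)
      ex = elementary-∘tail elementary-head

      ey : Elementaryⱽ (suc (suc p)) p (tail ∘ tail)
      ey i = elementary-∘tail (elementary-∘tail (elementary-lookup i))

      parity : Elementary (suc (suc p)) (λ v → pathSign (head (tail v)) (tail (tail v)) (code v) % 2)
      parity = elementary-% (elementary-pathSign ex ey elementary-code) (elementary-const 2) (λ _ → _)

      size : Elementary (suc (suc p)) (λ v → pathSize (head (tail v)) (tail (tail v)) (code v))
      size = elementary-pathSize ex ey elementary-code

      bound : Elementary (suc p) (λ w → K ^ head w)
      bound = elementary-^ K elementary-head

    elementary-evenPaths : Elementary (suc p) (λ w → evenPaths (head w) (tail w) c)
    elementary-evenPaths = elementary-∑< (elementary-* (elementary-∸ (elementary-const 1) parity) size) bound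

    elementary-oddPaths : Elementary (suc p) (λ w → oddPaths (head w) (tail w) c)
    elementary-oddPaths = elementary-∑< (elementary-* parity size) bound

mainTheorem11 : (p k : ℕ) (G : Vec ℕ p → Fin k → ℕ)
    (A : Vec ℕ (suc p) → Fin k → Fin k → ℤ) (B : Vec ℕ (suc p) → Fin k → ℤ)
    → ElementaryVec p k G → ElementaryZMat (suc p) k A → ElementaryZVec (suc p) k B
    → ElementaryZVec (suc p) k (λ xy → solutionAt p k G A B xy)
mainTheorem11 p k G A B eG eA eB i =
  ElementaryZ-resp-≗ (λ { (x ∷ y) → sym (solution-as-⊖ x y i) })
    (elementaryZ-⊖ (elementary-evenPaths (suc (toℕ i))) (elementary-oddPaths (suc (toℕ i))))
  where
  open LinearRecurrence G A B
  open ElementarySolution eG eA eB
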